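{- The following two statements are equivalent. (A) (Fan–Raspaud conjecture) Every bridgeless cubic graph admits an FR-triple. (B) For every bridgeless cubic graph $G$, every edge $e\in E(G)$ and every $i\in\{0,1,2\}$, there is an FR-triple $C$ of $G$ such that $\nu_C(e)=i$.
   Context: Graphs are finite. For a bridgeless cubic graph $G$ and a list $C=(F_1,\dots,F_k)$ of (not necessarily distinct) perfect matchings of $G$, $\nu_C(e)$ denotes the number of indices $t$ with $e\in F_t$. An FR-triple of a bridgeless cubic graph $G$ is a list $C=(F_1,F_2,F_3)$ of (not necessarily distinct) perfect matchings of $G$ such that $F_1\cap F_2\cap F_3=\emptyset$. -}

module Defs where

open import Data.Nat using (ℕ; zero; suc; _+_)
open import Data.Bool using (Bool; true; false; _∨_; if_then_else_)
open import Data.Fin using (Fin; zero; suc; _≟_)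
open import Data.Product using (Σ; _×_; _,_)
open import Relation.Nullary using (¬_)
open import Relation.Nullary.Decidable using (isYes)
open import Relation.Binary.PropositionalEquality using (_≡_)

-- Finite multigraph (parallel edges allowed), loopless:
-- vertices Fin n, edges Fin m, each edge has two distinct ends.
record Graph : Set where
  field
    n    : ℕ
    m    : ℕ
    end₁ : Fin m → Fin n
    end₂ : Fin m → Fin n
    loopless : ∀ e → ¬ (end₁ e ≡ end₂ e)
open Graph public

count : ∀ {k} → (Fin k → Bool) → ℕ
count {zero}  p = 0
count {suc k} p = (if p zero then 1 else 0) + count (λ i → p (suc i))

incident : (G : Graph) → Fin (m G) → Fin (n G) → Bool
incident G e v = isYes (end₁ G e ≟ v) ∨ isYes (end₂ G e ≟ v)

degree : (G : Graph) → Fin (n G) → ℕ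
degree G v = count (λ e → incident G e v)

Cubic : Graph → Set
Cubic G = ∀ v → degree G v ≡ 3

data ReachAvoiding (G : Graph) (e : Fin (m G)) : Fin (n G) → Fin (n G) → Set where
  here : ∀ {u} → ReachAvoiding G e u u
  step₁ : ∀ {w} (f : Fin (m G)) → ¬ (f ≡ e) →
          ReachAvoiding G e (end₂ G f) w → ReachAvoiding G e (end₁ G f) w
  step₂ : ∀ {w} (f : Fin (m G)) → ¬ (f ≡ e) →
          ReachAvoiding G e (end₁ G f) w → ReachAvoiding G e (end₂ G f) w

IsBridge : (G : Graph) → Fin (m G) → Set
IsBridge G e = ¬ ReachAvoiding G e (end₁ G e) (end₂ G e)

Bridgeless : Graph → Set
Bridgeless G = ∀ e → ¬ IsBridge G e

EdgeSet : Graph → Set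
EdgeSet G = Fin (m G) → Bool

IsPerfectMatching : (G : Graph) → EdgeSet G → Set
IsPerfectMatching G F = ∀ v → count (λ e → F e Data.Bool.∧ incident G e v) ≡ 1

PerfectMatching : Graph → Set
PerfectMatching G = Σ (EdgeSet G) (IsPerfectMatching G)

Triple : Graph → Set
Triple G = PerfectMatching G × PerfectMatching G × PerfectMatching G

ν : (G : Graph) → Triple G → Fin (m G) → ℕ
ν G ((F₁ , _) , (F₂ , _) , (F₃ , _)) e =
  (if F₁ e then 1 else 0) + (if F₂ e then 1 else 0) + (if F₃ e then 1 else 0)

IsFRTriple : (G : Graph) → Triple G → Set
IsFRTriple G ((F₁ , _) , (F₂ , _) , (F₃ , _)) =
  ∀ e → ¬ ((F₁ e ≡ true) × (F₂ e ≡ true) × (F₃ e ≡ true))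

-- Splicing G into an edge j of a cubic
-- bridgeless graph P (replace j = xy and e = uv by xu and vy) gives a cubic bridgeless graph in
-- which {j, e} is a 2-edge-cut around the even set V(G); so every perfect matching contains
-- both cut edges or neither, and an FR-triple of the spliced graph restricts to FR-triples of
-- P and of G with the same value at j and at e.  Splicing copies of G into every edge of G and
-- applying (A) yields an FR-triple T of G each of whose values ν_T(k) is realised at e.
-- If ν_T ≡ 1, T is a 3-edge-colouring and the triples (A, B, A) of two colour classes realise
-- 0 and 2.  Otherwise some ν_T(k) ∈ {0, 2}; as the three values around an end of k are at most
-- 2 and sum to 3, all of 0, 1, 2 then occur.

module Submission where

open import Defs
open import Data.Nat using (ℕ; zero; suc; _+_; _≤_; _<_; z≤n; s≤s; s≤s⁻¹) renaming (_≟_ to _≟ℕ_)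
open import Data.Nat.Properties
  using ( +-*-semiring; +-commutativeSemigroup; +-assoc; +-identityʳ; +-cancelʳ-≡; +-mono-≤; +-mono-<-≤
        ; *-comm; ≤-refl; ≤∧≢⇒<; n≢0⇒n>0; <-irrefl)
open import Data.Nat.Divisibility using (_∣_; divides; _∣0; ∣-refl; ∣m∣n⇒∣m+n; ∣m+n∣m⇒∣n; >⇒∤)
open import Algebra.Properties.CommutativeSemigroup +-commutativeSemigroup
  using (xy∙z≈zy∙x; xy∙z≈x∙zy; xy∙z≈xz∙y; xy∙z≈yz∙x)
open import Algebra.Properties.Semiring.Sum +-*-semiring
  using (sum; sum-cong-≗; sum-remove; sum-replicate-zero; ∑-distrib-+; ∑-comm)
open import Data.Bool using (Bool; true; false; _∨_; _∧_; if_then_else_)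
open import Data.Bool.Properties using (∧-identityʳ; ∧-zeroʳ; ∨-identityʳ)
open import Data.Fin using (Fin; zero; suc; _≟_; _↑ˡ_; _↑ʳ_; punchIn; splitAt; join; toℕ)
open import Data.Fin.Properties
  using ( any?; all?; ¬∀⟶∃¬; punchInᵢ≢i; splitAt-↑ˡ; splitAt-↑ʳ; join-splitAt
        ; ↑ˡ-injective; ↑ʳ-injective)
open import Data.Sum using (_⊎_; inj₁; inj₂)
open import Data.Product using (Σ; _×_; _,_; proj₁; proj₂; ∃-syntax)
open import Data.Vec using (Vec; []; _∷_)
import Data.Vec as Vec
open import Data.Vec.Properties using (lookup-allFin)
open import Data.Vec.Relation.Unary.All using (All; []; _∷_)
import Data.Vec.Relation.Unary.All.Properties as All
open import Data.Empty using (⊥; ⊥-elim)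
open import Function using (_∘_)
open import Relation.Nullary using (¬_; Dec; yes; no; contradiction)
open import Relation.Nullary.Decidable using (isYes; isYes≗does; dec-true; dec-false)
open import Relation.Binary.PropositionalEquality

χ : Bool → ℕ
χ b = if b then 1 else 0

count≡sum : ∀ {k} (p : Fin k → Bool) → count p ≡ sum (χ ∘ p)
count≡sum {zero}  p = refl
count≡sum {suc k} p = cong (χ (p zero) +_) (count≡sum (p ∘ suc))

sum-ones : ∀ k → sum {k} (λ _ → 1) ≡ k
sum-ones zero    = refl
sum-ones (suc k) = cong suc (sum-ones k)

sum-↑ : ∀ a {b} (f : Fin (a + b) → ℕ) → sum f ≡ sum (f ∘ (_↑ˡ b)) + sum (f ∘ (a ↑ʳ_))
sum-↑ zero    f = refl
sum-↑ (suc a) f = trans (cong (f zero +_) (sum-↑ a (f ∘ suc))) (sym (+-assoc (f zero) _ _))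

sum-agree-except : ∀ {k} (f g : Fin k → ℕ) z → (∀ i → i ≢ z → f i ≡ g i) →
                   sum f + g z ≡ sum g + f z
sum-agree-except {suc k} f g z agree = begin
  sum f + g z                        ≡⟨ cong (_+ g z) (sum-remove {i = z} f) ⟩
  f z + sum (f ∘ punchIn z) + g z    ≡⟨ cong (λ s → f z + s + g z) (sum-cong-≗ agree′) ⟩
  f z + sum (g ∘ punchIn z) + g z    ≡⟨ xy∙z≈zy∙x (f z) _ (g z) ⟩
  g z + sum (g ∘ punchIn z) + f z    ≡⟨ cong (_+ f z) (sum-remove {i = z} g) ⟨
  sum g + f z                        ∎
  where
  open ≡-Reasoning
  agree′ : ∀ i → f (punchIn z i) ≡ g (punchIn z i)
  agree′ i = agree (punchIn z i) (punchInᵢ≢i z i)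

sum-supported : ∀ {k} (f : Fin k → ℕ) z → (∀ i → i ≢ z → f i ≡ 0) → sum f ≡ f z
sum-supported {k} f z vanish = begin
  sum f                       ≡⟨ +-identityʳ (sum f) ⟨
  sum f + 0                   ≡⟨ sum-agree-except f (λ _ → 0) z vanish ⟩
  sum {k} (λ _ → 0) + f z     ≡⟨ cong (_+ f z) (sum-replicate-zero k) ⟩
  f z                         ∎
  where open ≡-Reasoning

sum-mono-≤ : ∀ {k} {f g : Fin k → ℕ} → (∀ i → f i ≤ g i) → sum f ≤ sum g
sum-mono-≤ {zero}  f≤g = z≤n
sum-mono-≤ {suc k} f≤g = +-mono-≤ (f≤g zero) (sum-mono-≤ (f≤g ∘ suc))

sum-mono-< : ∀ {k} (f g : Fin k → ℕ) z → (∀ i → f i ≤ g i) → f z < g z → sum f < sum g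
sum-mono-< {suc k} f g z f≤g fz<gz = subst₂ _<_ (sym (sum-remove {i = z} f)) (sym (sum-remove {i = z} g))
  (+-mono-<-≤ fz<gz (sum-mono-≤ (f≤g ∘ punchIn z)))

∣-sum : ∀ {d k} {f : Fin k → ℕ} → (∀ i → d ∣ f i) → d ∣ sum f
∣-sum {d} {zero} _   = d ∣0
∣-sum {d} {suc k} d∣f = ∣m∣n⇒∣m+n (d∣f zero) (∣-sum (d∣f ∘ suc))

count-↑ : ∀ a {b} (p : Fin (a + b) → Bool) →
          count p ≡ count (p ∘ (_↑ˡ b)) + count (p ∘ (a ↑ʳ_))
count-↑ a {b} p
  rewrite count≡sum p | count≡sum (p ∘ (_↑ˡ b)) | count≡sum (p ∘ (a ↑ʳ_)) = sum-↑ a (χ ∘ p)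

count-agree-except : ∀ {k} (p q : Fin k → Bool) z → (∀ i → i ≢ z → p i ≡ q i) →
                     count p + χ (q z) ≡ count q + χ (p z)
count-agree-except p q z agree rewrite count≡sum p | count≡sum q =
  sum-agree-except (χ ∘ p) (χ ∘ q) z (λ i i≢z → cong χ (agree i i≢z))

count-supported : ∀ {k} (p : Fin k → Bool) z → (∀ i → i ≢ z → p i ≡ false) → count p ≡ χ (p z)
count-supported p z vanish rewrite count≡sum p = sum-supported (χ ∘ p) z (λ i i≢z → cong χ (vanish i i≢z))

_≟ᵇ_ : ∀ {k} → Fin k → Fin k → Bool
a ≟ᵇ b = isYes (a ≟ b)

≟ᵇ-refl : ∀ {k} (a : Fin k) → (a ≟ᵇ a) ≡ true
≟ᵇ-refl a = trans (isYes≗does (a ≟ a)) (dec-true (a ≟ a) refl)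

≟ᵇ-≢ : ∀ {k} {a b : Fin k} → a ≢ b → (a ≟ᵇ b) ≡ false
≟ᵇ-≢ {a = a} {b} a≢b = trans (isYes≗does (a ≟ b)) (dec-false (a ≟ b) a≢b)

≟ᵇ⇒≡ : ∀ {k} {a b : Fin k} → (a ≟ᵇ b) ≡ true → a ≡ b
≟ᵇ⇒≡ {a = a} {b} a≟b with a ≟ b
... | yes a≡b = a≡b
≟ᵇ⇒≡ () | no _

χ-∧-≟ᵇ : ∀ {k} c (a : Fin k) → sum (λ b → χ (c ∧ (a ≟ᵇ b))) ≡ χ c
χ-∧-≟ᵇ c a = begin
  sum (λ b → χ (c ∧ (a ≟ᵇ b)))  ≡⟨ sum-supported _ a off-a ⟩
  χ (c ∧ (a ≟ᵇ a))              ≡⟨ cong (λ t → χ (c ∧ t)) (≟ᵇ-refl a) ⟩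
  χ (c ∧ true)                  ≡⟨ cong χ (∧-identityʳ c) ⟩
  χ c                           ∎
  where
  open ≡-Reasoning
  off-a : ∀ b → b ≢ a → χ (c ∧ (a ≟ᵇ b)) ≡ 0
  off-a b b≢a rewrite ≟ᵇ-≢ (b≢a ∘ sym) | ∧-zeroʳ c = refl

χ-∧-∨ : ∀ c a b → (a ≡ true → b ≡ true → ⊥) → χ (c ∧ (a ∨ b)) ≡ χ (c ∧ a) + χ (c ∧ b)
χ-∧-∨ false a     b     _    = refl
χ-∧-∨ true  false b     _    = refl
χ-∧-∨ true  true  false _    = refl
χ-∧-∨ true  true  true  both = ⊥-elim (both refl refl)

χ-∧-incident : ∀ Γ c (f : Fin (m Γ)) v →
               χ (c ∧ incident Γ f v) ≡ χ (c ∧ (end₁ Γ f ≟ᵇ v)) + χ (c ∧ (end₂ Γ f ≟ᵇ v))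
χ-∧-incident Γ c f v =
  χ-∧-∨ c _ _ λ at₁ at₂ → loopless Γ f (trans (≟ᵇ⇒≡ at₁) (sym (≟ᵇ⇒≡ at₂)))

degreeIn : (Γ : Graph) → EdgeSet Γ → Fin (n Γ) → ℕ
degreeIn Γ W v = count (λ f → W f ∧ incident Γ f v)

handshake : ∀ Γ (W : EdgeSet Γ) → sum (degreeIn Γ W) ≡ count W + count W
handshake Γ W = begin
  sum (degreeIn Γ W)                                ≡⟨ sum-cong-≗ (λ v → count≡sum (W∧incident v)) ⟩
  sum (λ v → sum (λ f → χ (W∧incident v f)))        ≡⟨ ∑-comm (λ v f → χ (W∧incident v f)) ⟩
  sum (λ f → sum (λ v → χ (W∧incident v f)))        ≡⟨ sum-cong-≗ edge-counted-twice ⟩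
  sum (λ f → χ (W f) + χ (W f))                     ≡⟨ ∑-distrib-+ (χ ∘ W) (χ ∘ W) ⟩
  sum (χ ∘ W) + sum (χ ∘ W)                         ≡⟨ cong₂ _+_ (count≡sum W) (count≡sum W) ⟨
  count W + count W                                 ∎
  where
  open ≡-Reasoning
  W∧incident : Fin (n Γ) → Fin (m Γ) → Bool
  W∧incident v f = W f ∧ incident Γ f v
  W∧at : Fin (m Γ) → Fin (n Γ) → Fin (n Γ) → ℕ
  W∧at f a v = χ (W f ∧ (a ≟ᵇ v))
  edge-counted-twice : ∀ f → sum (λ v → χ (W∧incident v f)) ≡ χ (W f) + χ (W f)
  edge-counted-twice f = begin
    sum (λ v → χ (W∧incident v f))                      ≡⟨ sum-cong-≗ (χ-∧-incident Γ (W f) f) ⟩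
    sum (λ v → W∧at f (end₁ Γ f) v + W∧at f (end₂ Γ f) v) ≡⟨ ∑-distrib-+ (W∧at f (end₁ Γ f)) (W∧at f (end₂ Γ f)) ⟩
    sum (W∧at f (end₁ Γ f)) + sum (W∧at f (end₂ Γ f))   ≡⟨ cong₂ _+_ (χ-∧-≟ᵇ (W f) (end₁ Γ f)) (χ-∧-≟ᵇ (W f) (end₂ Γ f)) ⟩
    χ (W f) + χ (W f)                                   ∎

2∣m+m : ∀ m → 2 ∣ m + m
2∣m+m m = divides m (trans (cong (m +_) (sym (+-identityʳ m))) (*-comm 2 m))

perfectMatching⇒even : ∀ Γ {F} → IsPerfectMatching Γ F → 2 ∣ n Γ
perfectMatching⇒even Γ {F} isPM = subst (2 ∣_) n≡2|F| (2∣m+m (count F))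
  where
  n≡2|F| : count F + count F ≡ n Γ
  n≡2|F| = trans (sym (handshake Γ F)) (trans (sum-cong-≗ isPM) (sum-ones (n Γ)))

2∤1 : ¬ 2 ∣ 1
2∤1 = >⇒∤ (s≤s (s≤s z≤n))

χ-injective-mod-2 : ∀ {m n} a b → 2 ∣ m → 2 ∣ n → m + χ a ≡ n + χ b → a ≡ b
χ-injective-mod-2 false false _ _ _ = refl
χ-injective-mod-2 true  true  _ _ _ = refl
χ-injective-mod-2 {m} {n} true false 2∣m 2∣n eq =
  ⊥-elim (2∤1 (∣m+n∣m⇒∣n (subst (2 ∣_) (trans (sym (+-identityʳ n)) (sym eq)) 2∣n) 2∣m))
χ-injective-mod-2 {m} {n} false true 2∣m 2∣n eq =
  ⊥-elim (2∤1 (∣m+n∣m⇒∣n (subst (2 ∣_) (trans (sym (+-identityʳ m)) eq) 2∣m) 2∣n))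

↑ˡ≢↑ʳ : ∀ {a b} (i : Fin a) (k : Fin b) → i ↑ˡ b ≢ a ↑ʳ k
↑ˡ≢↑ʳ {a} {b} i k eq with trans (sym (splitAt-↑ˡ a i b)) (trans (cong (splitAt a) eq) (splitAt-↑ʳ a b k))
... | ()

Fin-+-ind : ∀ {a b} (Q : Fin (a + b) → Set) → (∀ i → Q (i ↑ˡ b)) → (∀ k → Q (a ↑ʳ k)) → ∀ l → Q l
Fin-+-ind {a} {b} Q onLeft onRight l = subst Q (join-splitAt a b l) (onSplit (splitAt a l))
  where
  onSplit : (s : Fin a ⊎ Fin b) → Q (join a b s)
  onSplit (inj₁ i) = onLeft i
  onSplit (inj₂ k) = onRight k

≟ᵇ-↑ˡ : ∀ {a} b (i i′ : Fin a) → ((i ↑ˡ b) ≟ᵇ (i′ ↑ˡ b)) ≡ (i ≟ᵇ i′)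
≟ᵇ-↑ˡ b i i′ with i ≟ i′
... | yes refl = ≟ᵇ-refl (i ↑ˡ b)
... | no i≢i′  = ≟ᵇ-≢ (i≢i′ ∘ ↑ˡ-injective b i i′)

≟ᵇ-↑ʳ : ∀ a {b} (k k′ : Fin b) → ((a ↑ʳ k) ≟ᵇ (a ↑ʳ k′)) ≡ (k ≟ᵇ k′)
≟ᵇ-↑ʳ a k k′ with k ≟ k′
... | yes refl = ≟ᵇ-refl (a ↑ʳ k)
... | no k≢k′  = ≟ᵇ-≢ (k≢k′ ∘ ↑ʳ-injective a k k′)

≟ᵇ-↑ˡ↑ʳ : ∀ {a b} (i : Fin a) (k : Fin b) → ((i ↑ˡ b) ≟ᵇ (a ↑ʳ k)) ≡ false
≟ᵇ-↑ˡ↑ʳ i k = ≟ᵇ-≢ (↑ˡ≢↑ʳ i k)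

≟ᵇ-↑ʳ↑ˡ : ∀ {a b} (i : Fin a) (k : Fin b) → ((a ↑ʳ k) ≟ᵇ (i ↑ˡ b)) ≡ false
≟ᵇ-↑ʳ↑ˡ i k = ≟ᵇ-≢ (↑ˡ≢↑ʳ i k ∘ sym)

module _ {Γ : Graph} {h : Fin (m Γ)} where

  reach-trans : ∀ {a b c} → ReachAvoiding Γ h a b → ReachAvoiding Γ h b c → ReachAvoiding Γ h a c
  reach-trans here             q = q
  reach-trans (step₁ f f≢h r) q = step₁ f f≢h (reach-trans r q)
  reach-trans (step₂ f f≢h r) q = step₂ f f≢h (reach-trans r q)

  reach-sym : ∀ {a b} → ReachAvoiding Γ h a b → ReachAvoiding Γ h b a
  reach-sym here             = here
  reach-sym (step₁ f f≢h r) = reach-trans (reach-sym r) (step₂ f f≢h here)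
  reach-sym (step₂ f f≢h r) = reach-trans (reach-sym r) (step₁ f f≢h here)

  reach-edge : ∀ f → f ≢ h → ReachAvoiding Γ h (end₁ Γ f) (end₂ Γ f)
  reach-edge f f≢h = step₁ f f≢h here

reach-map : ∀ {Γ Δ : Graph} {g : Fin (m Γ)} {h : Fin (m Δ)} (φ : Fin (n Γ) → Fin (n Δ)) →
            (∀ f → f ≢ g → ReachAvoiding Δ h (φ (end₁ Γ f)) (φ (end₂ Γ f))) →
            ∀ {a b} → ReachAvoiding Γ g a b → ReachAvoiding Δ h (φ a) (φ b)
reach-map φ edge here             = here
reach-map φ edge (step₁ f f≢g r) = reach-trans (edge f f≢g) (reach-map φ edge r)
reach-map φ edge (step₂ f f≢g r) = reach-trans (reach-sym (edge f f≢g)) (reach-map φ edge r)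

-- The edges j and e of H join x to u and v to y; all other edges are those of P and G.
module Splice (P G : Graph) (j : Fin (m P)) (e : Fin (m G)) where

  x y : Fin (n P)
  x = end₁ P j
  y = end₂ P j

  u v : Fin (n G)
  u = end₁ G e
  v = end₂ G e

  inP : Fin (n P) → Fin (n P + n G)
  inP a = a ↑ˡ n G

  inG : Fin (n G) → Fin (n P + n G)
  inG b = n P ↑ʳ b

  edgeP : Fin (m P) → Fin (m P + m G)
  edgeP k = k ↑ˡ m G

  edgeG : Fin (m G) → Fin (m P + m G)
  edgeG f = m P ↑ʳ f

  private
    ends₁ ends₂ : Fin (m P) ⊎ Fin (m G) → Fin (n P + n G)
    ends₁ (inj₁ k) = inP (end₁ P k)
    ends₁ (inj₂ f) with f ≟ e
    ... | yes _ = inG v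
    ... | no _  = inG (end₁ G f)
    ends₂ (inj₁ k) with k ≟ j
    ... | yes _ = inG u
    ... | no _  = inP (end₂ P k)
    ends₂ (inj₂ f) with f ≟ e
    ... | yes _ = inP y
    ... | no _  = inG (end₂ G f)

    ends-distinct : ∀ s → ends₁ s ≢ ends₂ s
    ends-distinct (inj₁ k) eq with k ≟ j
    ... | yes _ = ↑ˡ≢↑ʳ _ _ eq
    ... | no _  = loopless P k (↑ˡ-injective (n G) _ _ eq)
    ends-distinct (inj₂ f) eq with f ≟ e
    ... | yes _ = ↑ˡ≢↑ʳ _ _ (sym eq)
    ... | no _  = loopless G f (↑ʳ-injective (n P) _ _ eq)

  H : Graph
  H = record
    { n        = n P + n G
    ; m        = m P + m G
    ; end₁     = ends₁ ∘ splitAt (m P)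
    ; end₂     = ends₂ ∘ splitAt (m P)
    ; loopless = ends-distinct ∘ splitAt (m P)
    }

  end₁-edgeP : ∀ k → end₁ H (edgeP k) ≡ inP (end₁ P k)
  end₁-edgeP k = cong ends₁ (splitAt-↑ˡ (m P) k (m G))

  end₂-edgeP : ∀ k → k ≢ j → end₂ H (edgeP k) ≡ inP (end₂ P k)
  end₂-edgeP k k≢j rewrite splitAt-↑ˡ (m P) k (m G) with k ≟ j
  ... | yes k≡j = contradiction k≡j k≢j
  ... | no _    = refl

  end₂-edgeP-j : end₂ H (edgeP j) ≡ inG u
  end₂-edgeP-j rewrite splitAt-↑ˡ (m P) j (m G) with j ≟ j
  ... | yes _   = refl
  ... | no j≢j  = contradiction refl j≢j

  end₁-edgeG : ∀ f → f ≢ e → end₁ H (edgeG f) ≡ inG (end₁ G f)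
  end₁-edgeG f f≢e rewrite splitAt-↑ʳ (m P) (m G) f with f ≟ e
  ... | yes f≡e = contradiction f≡e f≢e
  ... | no _    = refl

  end₂-edgeG : ∀ f → f ≢ e → end₂ H (edgeG f) ≡ inG (end₂ G f)
  end₂-edgeG f f≢e rewrite splitAt-↑ʳ (m P) (m G) f with f ≟ e
  ... | yes f≡e = contradiction f≡e f≢e
  ... | no _    = refl

  end₁-edgeG-e : end₁ H (edgeG e) ≡ inG v
  end₁-edgeG-e rewrite splitAt-↑ʳ (m P) (m G) e with e ≟ e
  ... | yes _  = refl
  ... | no e≢e = contradiction refl e≢e

  end₂-edgeG-e : end₂ H (edgeG e) ≡ inP y
  end₂-edgeG-e rewrite splitAt-↑ʳ (m P) (m G) e with e ≟ e
  ... | yes _  = refl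
  ... | no e≢e = contradiction refl e≢e

  incident-edgeP-inP : ∀ k a → k ≢ j → incident H (edgeP k) (inP a) ≡ incident P k a
  incident-edgeP-inP k a k≢j
    rewrite end₁-edgeP k | end₂-edgeP k k≢j | ≟ᵇ-↑ˡ (n G) (end₁ P k) a | ≟ᵇ-↑ˡ (n G) (end₂ P k) a = refl

  incident-edgeP-inG : ∀ k b → k ≢ j → incident H (edgeP k) (inG b) ≡ false
  incident-edgeP-inG k b k≢j
    rewrite end₁-edgeP k | end₂-edgeP k k≢j | ≟ᵇ-↑ˡ↑ʳ (end₁ P k) b | ≟ᵇ-↑ˡ↑ʳ (end₂ P k) b = refl

  incident-edgeG-inP : ∀ f a → f ≢ e → incident H (edgeG f) (inP a) ≡ false
  incident-edgeG-inP f a f≢e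
    rewrite end₁-edgeG f f≢e | end₂-edgeG f f≢e | ≟ᵇ-↑ʳ↑ˡ a (end₁ G f) | ≟ᵇ-↑ʳ↑ˡ a (end₂ G f) = refl

  incident-edgeG-inG : ∀ f b → f ≢ e → incident H (edgeG f) (inG b) ≡ incident G f b
  incident-edgeG-inG f b f≢e
    rewrite end₁-edgeG f f≢e | end₂-edgeG f f≢e | ≟ᵇ-↑ʳ (n P) (end₁ G f) b | ≟ᵇ-↑ʳ (n P) (end₂ G f) b = refl

  incident-j-inP : ∀ a → incident H (edgeP j) (inP a) ≡ (x ≟ᵇ a)
  incident-j-inP a
    rewrite end₁-edgeP j | end₂-edgeP-j | ≟ᵇ-↑ˡ (n G) x a | ≟ᵇ-↑ʳ↑ˡ a u = ∨-identityʳ _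

  incident-j-inG : ∀ b → incident H (edgeP j) (inG b) ≡ (u ≟ᵇ b)
  incident-j-inG b
    rewrite end₁-edgeP j | end₂-edgeP-j | ≟ᵇ-↑ˡ↑ʳ x b | ≟ᵇ-↑ʳ (n P) u b = refl

  incident-e-inP : ∀ a → incident H (edgeG e) (inP a) ≡ (y ≟ᵇ a)
  incident-e-inP a
    rewrite end₁-edgeG-e | end₂-edgeG-e | ≟ᵇ-↑ʳ↑ˡ a v | ≟ᵇ-↑ˡ (n G) y a = refl

  incident-e-inG : ∀ b → incident H (edgeG e) (inG b) ≡ (v ≟ᵇ b)
  incident-e-inG b
    rewrite end₁-edgeG-e | end₂-edgeG-e | ≟ᵇ-↑ʳ (n P) v b | ≟ᵇ-↑ˡ↑ʳ y b = ∨-identityʳ _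

  -- In H the end y of j has become an end of e; the χ-terms account for exactly that.
  module _ (W : EdgeSet H) where

    private
      onJ onE : Bool
      onJ = W (edgeP j)
      onE = W (edgeG e)

    degree-inP : ∀ a → degreeIn H W (inP a) + χ (onJ ∧ (y ≟ᵇ a))
                     ≡ degreeIn P (W ∘ edgeP) a + χ (onE ∧ (y ≟ᵇ a))
    degree-inP a = begin
      degreeIn H W (inP a) + χ (onJ ∧ (y ≟ᵇ a))    ≡⟨ cong (_+ χ (onJ ∧ (y ≟ᵇ a))) (count-↑ (m P) _) ⟩
      count A + count B + χ (onJ ∧ (y ≟ᵇ a))       ≡⟨ xy∙z≈xz∙y (count A) _ _ ⟩
      count A + χ (onJ ∧ (y ≟ᵇ a)) + count B       ≡⟨ cong₂ _+_ P-part G-part ⟩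
      degreeIn P (W ∘ edgeP) a + χ (onE ∧ (y ≟ᵇ a)) ∎
      where
      open ≡-Reasoning
      A : Fin (m P) → Bool
      A k = W (edgeP k) ∧ incident H (edgeP k) (inP a)
      B : Fin (m G) → Bool
      B f = W (edgeG f) ∧ incident H (edgeG f) (inP a)
      G-part : count B ≡ χ (onE ∧ (y ≟ᵇ a))
      G-part = trans (count-supported B e vanish) (cong (λ t → χ (onE ∧ t)) (incident-e-inP a))
        where
        vanish : ∀ f → f ≢ e → B f ≡ false
        vanish f f≢e rewrite incident-edgeG-inP f a f≢e = ∧-zeroʳ _
      agree : ∀ k → k ≢ j → A k ≡ (W (edgeP k) ∧ incident P k a)
      agree k k≢j = cong (W (edgeP k) ∧_) (incident-edgeP-inP k a k≢j)
      P-part : count A + χ (onJ ∧ (y ≟ᵇ a)) ≡ degreeIn P (W ∘ edgeP) a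
      P-part = +-cancelʳ-≡ (χ (onJ ∧ (x ≟ᵇ a))) _ _ (begin
        count A + χ (onJ ∧ (y ≟ᵇ a)) + χ (onJ ∧ (x ≟ᵇ a))
          ≡⟨ xy∙z≈x∙zy (count A) _ _ ⟩
        count A + (χ (onJ ∧ (x ≟ᵇ a)) + χ (onJ ∧ (y ≟ᵇ a)))
          ≡⟨ cong (count A +_) (χ-∧-incident P onJ j a) ⟨
        count A + χ (onJ ∧ incident P j a)
          ≡⟨ count-agree-except A _ j agree ⟩
        degreeIn P (W ∘ edgeP) a + χ (A j)
          ≡⟨ cong (λ t → degreeIn P (W ∘ edgeP) a + χ (onJ ∧ t)) (incident-j-inP a) ⟩
        degreeIn P (W ∘ edgeP) a + χ (onJ ∧ (x ≟ᵇ a))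
          ∎)

    degree-inG : ∀ b → degreeIn H W (inG b) + χ (onE ∧ (u ≟ᵇ b))
                     ≡ degreeIn G (W ∘ edgeG) b + χ (onJ ∧ (u ≟ᵇ b))
    degree-inG b = begin
      degreeIn H W (inG b) + χ (onE ∧ (u ≟ᵇ b))    ≡⟨ cong (_+ χ (onE ∧ (u ≟ᵇ b))) (count-↑ (m P) _) ⟩
      count A + count B + χ (onE ∧ (u ≟ᵇ b))       ≡⟨ xy∙z≈yz∙x (count A) _ _ ⟩
      count B + χ (onE ∧ (u ≟ᵇ b)) + count A       ≡⟨ cong₂ _+_ G-part P-part ⟩
      degreeIn G (W ∘ edgeG) b + χ (onJ ∧ (u ≟ᵇ b)) ∎
      where
      open ≡-Reasoning
      A : Fin (m P) → Bool
      A k = W (edgeP k) ∧ incident H (edgeP k) (inG b)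
      B : Fin (m G) → Bool
      B f = W (edgeG f) ∧ incident H (edgeG f) (inG b)
      P-part : count A ≡ χ (onJ ∧ (u ≟ᵇ b))
      P-part = trans (count-supported A j vanish) (cong (λ t → χ (onJ ∧ t)) (incident-j-inG b))
        where
        vanish : ∀ k → k ≢ j → A k ≡ false
        vanish k k≢j rewrite incident-edgeP-inG k b k≢j = ∧-zeroʳ _
      agree : ∀ f → f ≢ e → B f ≡ (W (edgeG f) ∧ incident G f b)
      agree f f≢e = cong (W (edgeG f) ∧_) (incident-edgeG-inG f b f≢e)
      G-part : count B + χ (onE ∧ (u ≟ᵇ b)) ≡ degreeIn G (W ∘ edgeG) b
      G-part = +-cancelʳ-≡ (χ (onE ∧ (v ≟ᵇ b))) _ _ (begin
        count B + χ (onE ∧ (u ≟ᵇ b)) + χ (onE ∧ (v ≟ᵇ b))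
          ≡⟨ +-assoc (count B) _ _ ⟩
        count B + (χ (onE ∧ (u ≟ᵇ b)) + χ (onE ∧ (v ≟ᵇ b)))
          ≡⟨ cong (count B +_) (χ-∧-incident G onE e b) ⟨
        count B + χ (onE ∧ incident G e b)
          ≡⟨ count-agree-except B _ e agree ⟩
        degreeIn G (W ∘ edgeG) b + χ (B e)
          ≡⟨ cong (λ t → degreeIn G (W ∘ edgeG) b + χ (onE ∧ t)) (incident-e-inG b) ⟩
        degreeIn G (W ∘ edgeG) b + χ (onE ∧ (v ≟ᵇ b))
          ∎)

  cubic : Cubic P → Cubic G → Cubic H
  cubic cubicP cubicG = Fin-+-ind (λ w → degree H w ≡ 3)
    (λ a → +-cancelʳ-≡ (χ (y ≟ᵇ a)) _ _ (trans (degree-inP all a) (cong (_+ χ (y ≟ᵇ a)) (cubicP a))))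
    (λ b → +-cancelʳ-≡ (χ (u ≟ᵇ b)) _ _ (trans (degree-inG all b) (cong (_+ χ (u ≟ᵇ b)) (cubicG b))))
    where
    all : EdgeSet H
    all _ = true

  module Restrict {F : EdgeSet H} (isPM : IsPerfectMatching H F) (2∣nG : 2 ∣ n G) where

    private
      onJ onE : Bool
      onJ = F (edgeP j)
      onE = F (edgeG e)

    -- Summing degree-inG over the vertices of G: n G + [e ∈ F] = 2 |F ∩ E(G)| + [j ∈ F],
    -- so the 2-edge-cut {j, e} around the even set V(G) meets F in an even number of edges.
    cut-parity : onJ ≡ onE
    cut-parity = sym (χ-injective-mod-2 onE onJ 2∣nG (2∣m+m (count (F ∘ edgeG))) (begin
      n G + χ onE
        ≡⟨ cong₂ _+_ (sum-ones (n G)) (χ-∧-≟ᵇ onE u) ⟨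
      sum {n G} (λ _ → 1) + sum (λ b → χ (onE ∧ (u ≟ᵇ b)))
        ≡⟨ ∑-distrib-+ {n G} (λ _ → 1) _ ⟨
      sum (λ b → 1 + χ (onE ∧ (u ≟ᵇ b)))
        ≡⟨ sum-cong-≗ matched-inG ⟩
      sum (λ b → degreeIn G (F ∘ edgeG) b + χ (onJ ∧ (u ≟ᵇ b)))
        ≡⟨ ∑-distrib-+ (degreeIn G (F ∘ edgeG)) _ ⟩
      sum (degreeIn G (F ∘ edgeG)) + sum (λ b → χ (onJ ∧ (u ≟ᵇ b)))
        ≡⟨ cong₂ _+_ (handshake G (F ∘ edgeG)) (χ-∧-≟ᵇ onJ u) ⟩
      count (F ∘ edgeG) + count (F ∘ edgeG) + χ onJ
        ∎))
      where
      open ≡-Reasoning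
      matched-inG : ∀ b → 1 + χ (onE ∧ (u ≟ᵇ b)) ≡ degreeIn G (F ∘ edgeG) b + χ (onJ ∧ (u ≟ᵇ b))
      matched-inG b = trans (cong (_+ χ (onE ∧ (u ≟ᵇ b))) (sym (isPM (inG b)))) (degree-inG F b)

    restrictP : IsPerfectMatching P (F ∘ edgeP)
    restrictP a = +-cancelʳ-≡ (χ (onE ∧ (y ≟ᵇ a))) _ _ (begin
      degreeIn P (F ∘ edgeP) a + χ (onE ∧ (y ≟ᵇ a))  ≡⟨ degree-inP F a ⟨
      degreeIn H F (inP a) + χ (onJ ∧ (y ≟ᵇ a))      ≡⟨ cong₂ (λ d c → d + χ (c ∧ (y ≟ᵇ a))) (isPM (inP a)) cut-parity ⟩
      1 + χ (onE ∧ (y ≟ᵇ a))                         ∎)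
      where open ≡-Reasoning

    restrictG : IsPerfectMatching G (F ∘ edgeG)
    restrictG b = +-cancelʳ-≡ (χ (onJ ∧ (u ≟ᵇ b))) _ _ (begin
      degreeIn G (F ∘ edgeG) b + χ (onJ ∧ (u ≟ᵇ b))  ≡⟨ degree-inG F b ⟨
      degreeIn H F (inG b) + χ (onE ∧ (u ≟ᵇ b))      ≡⟨ cong₂ (λ d c → d + χ (c ∧ (u ≟ᵇ b))) (isPM (inG b)) (sym cut-parity) ⟩
      1 + χ (onJ ∧ (u ≟ᵇ b))                         ∎)
      where open ≡-Reasoning

  restrictPMᴾ : 2 ∣ n G → PerfectMatching H → PerfectMatching P
  restrictPMᴾ 2∣nG (F , isPM) = F ∘ edgeP , Restrict.restrictP isPM 2∣nG

  restrictPMᴳ : 2 ∣ n G → PerfectMatching H → PerfectMatching G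
  restrictPMᴳ 2∣nG (F , isPM) = F ∘ edgeG , Restrict.restrictG isPM 2∣nG

  restrictᴾ : 2 ∣ n G → Triple H → Triple P
  restrictᴾ 2∣nG (M₁ , M₂ , M₃) = restrictPMᴾ 2∣nG M₁ , restrictPMᴾ 2∣nG M₂ , restrictPMᴾ 2∣nG M₃

  restrictᴳ : 2 ∣ n G → Triple H → Triple G
  restrictᴳ 2∣nG (M₁ , M₂ , M₃) = restrictPMᴳ 2∣nG M₁ , restrictPMᴳ 2∣nG M₂ , restrictPMᴳ 2∣nG M₃

  ν-restrict-cut : (2∣nG : 2 ∣ n G) (T : Triple H) →
                   ν G (restrictᴳ 2∣nG T) e ≡ ν P (restrictᴾ 2∣nG T) j
  ν-restrict-cut 2∣nG ((F₁ , pm₁) , (F₂ , pm₂) , (F₃ , pm₃)) =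
    cong₂ _+_ (cong₂ _+_ (parity pm₁) (parity pm₂)) (parity pm₃)
    where
    parity : ∀ {F} → IsPerfectMatching H F → χ (F (edgeG e)) ≡ χ (F (edgeP j))
    parity isPM = cong χ (sym (Restrict.cut-parity isPM 2∣nG))

  module _ {h : Fin (m H)} where

    reach-edgeP : ∀ k → k ≢ j → edgeP k ≢ h → ReachAvoiding H h (inP (end₁ P k)) (inP (end₂ P k))
    reach-edgeP k k≢j k≢h =
      subst₂ (ReachAvoiding H h) (end₁-edgeP k) (end₂-edgeP k k≢j) (reach-edge (edgeP k) k≢h)

    reach-edgeG : ∀ f → f ≢ e → edgeG f ≢ h → ReachAvoiding H h (inG (end₁ G f)) (inG (end₂ G f))
    reach-edgeG f f≢e f≢h =
      subst₂ (ReachAvoiding H h) (end₁-edgeG f f≢e) (end₂-edgeG f f≢e) (reach-edge (edgeG f) f≢h)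

    reach-j : edgeP j ≢ h → ReachAvoiding H h (inP x) (inG u)
    reach-j j≢h = subst₂ (ReachAvoiding H h) (end₁-edgeP j) end₂-edgeP-j (reach-edge (edgeP j) j≢h)

    reach-e : edgeG e ≢ h → ReachAvoiding H h (inG v) (inP y)
    reach-e e≢h = subst₂ (ReachAvoiding H h) end₁-edgeG-e end₂-edgeG-e (reach-edge (edgeG e) e≢h)

    liftP : (∀ k → k ≢ j → edgeP k ≢ h) →
            ∀ {a b} → ReachAvoiding P j a b → ReachAvoiding H h (inP a) (inP b)
    liftP avoid = reach-map inP (λ k k≢j → reach-edgeP k k≢j (avoid k k≢j))

    liftG : (∀ f → f ≢ e → edgeG f ≢ h) →
            ∀ {a b} → ReachAvoiding G e a b → ReachAvoiding H h (inG a) (inG b)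
    liftG avoid = reach-map inG (λ f f≢e → reach-edgeG f f≢e (avoid f f≢e))

    bridge-between : ∀ {a b} → end₁ H h ≡ a → end₂ H h ≡ b → IsBridge H h → ¬ ReachAvoiding H h a b
    bridge-between refl refl bridge = bridge

  edgeP≢edgeG : ∀ k f → edgeP k ≢ edgeG f
  edgeP≢edgeG = ↑ˡ≢↑ʳ

  edgeG≢edgeP : ∀ f k → edgeG f ≢ edgeP k
  edgeG≢edgeP f k = ↑ˡ≢↑ʳ k f ∘ sym

  -- j and e lie on the cycle x ⇝ y –e– v ⇝ u –j– x, whose two paths avoid j in P and e in G.
  j-not-bridge : Bridgeless P → Bridgeless G → ¬ IsBridge H (edgeP j)
  j-not-bridge bridgelessP bridgelessG bridge =
    bridgelessP j λ x⇝y → bridgelessG e λ u⇝v →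
      bridge-between (end₁-edgeP j) end₂-edgeP-j bridge
        (reach-trans (liftP (λ k k≢j → k≢j ∘ ↑ˡ-injective (m G) k j) x⇝y)
        (reach-trans (reach-sym (reach-e (edgeG≢edgeP e j)))
                     (reach-sym (liftG (λ f _ → edgeG≢edgeP f j) u⇝v))))

  e-not-bridge : Bridgeless P → Bridgeless G → ¬ IsBridge H (edgeG e)
  e-not-bridge bridgelessP bridgelessG bridge =
    bridgelessP j λ x⇝y → bridgelessG e λ u⇝v →
      bridge-between end₁-edgeG-e end₂-edgeG-e bridge
        (reach-trans (reach-sym (liftG (λ f f≢e → f≢e ∘ ↑ʳ-injective (m P) f e) u⇝v))
        (reach-trans (reach-sym (reach-j (edgeP≢edgeG j e)))
                     (liftP (λ k _ → edgeP≢edgeG k e) x⇝y)))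

  -- Another edge lies on a cycle of P (or G); where that cycle uses j (or e), it is rerouted
  -- through the other side along a path avoiding the other cut edge.
  edgeP-not-bridge : Bridgeless P → Bridgeless G → ∀ k → k ≢ j → ¬ IsBridge H (edgeP k)
  edgeP-not-bridge bridgelessP bridgelessG k k≢j bridge =
    bridgelessP k λ cycle → bridgelessG e λ u⇝v →
      bridge-between (end₁-edgeP k) (end₂-edgeP k k≢j) bridge (reach-map inP (reroute u⇝v) cycle)
    where
    reroute : ReachAvoiding G e u v →
              ∀ f → f ≢ k → ReachAvoiding H (edgeP k) (inP (end₁ P f)) (inP (end₂ P f))
    reroute u⇝v f f≢k with f ≟ j
    ... | yes refl = reach-trans (reach-j (k≢j ∘ sym ∘ ↑ˡ-injective (m G) j k))
                     (reach-trans (liftG (λ f′ _ → edgeG≢edgeP f′ k) u⇝v) (reach-e (edgeG≢edgeP e k)))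
    ... | no f≢j   = reach-edgeP f f≢j (f≢k ∘ ↑ˡ-injective (m G) f k)

  edgeG-not-bridge : Bridgeless P → Bridgeless G → ∀ f → f ≢ e → ¬ IsBridge H (edgeG f)
  edgeG-not-bridge bridgelessP bridgelessG f f≢e bridge =
    bridgelessG f λ cycle → bridgelessP j λ x⇝y →
      bridge-between (end₁-edgeG f f≢e) (end₂-edgeG f f≢e) bridge (reach-map inG (reroute x⇝y) cycle)
    where
    reroute : ReachAvoiding P j x y →
              ∀ g → g ≢ f → ReachAvoiding H (edgeG f) (inG (end₁ G g)) (inG (end₂ G g))
    reroute x⇝y g g≢f with g ≟ e
    ... | yes refl = reach-trans (reach-sym (reach-j (edgeP≢edgeG j f)))
                     (reach-trans (liftP (λ k _ → edgeP≢edgeG k f) x⇝y)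
                                  (reach-sym (reach-e (f≢e ∘ sym ∘ ↑ʳ-injective (m P) e f))))
    ... | no g≢e   = reach-edgeG g g≢e (g≢f ∘ ↑ʳ-injective (m P) g f)

  bridgeless : Bridgeless P → Bridgeless G → Bridgeless H
  bridgeless bridgelessP bridgelessG = Fin-+-ind (λ h → ¬ IsBridge H h) onP onG
    where
    onP : ∀ k → ¬ IsBridge H (edgeP k)
    onP k with k ≟ j
    ... | yes refl = j-not-bridge bridgelessP bridgelessG
    ... | no k≢j   = edgeP-not-bridge bridgelessP bridgelessG k k≢j
    onG : ∀ f → ¬ IsBridge H (edgeG f)
    onG f with f ≟ e
    ... | yes refl = e-not-bridge bridgelessP bridgelessG
    ... | no f≢e   = edgeG-not-bridge bridgelessP bridgelessG f f≢e

RealisedAt : (G : Graph) → Fin (m G) → (P : Graph) → Triple P → Fin (m P) → Set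
RealisedAt G e P T k = Σ (Triple G) (λ C → IsFRTriple G C × ν G C e ≡ ν P T k)

FanRaspaud : Set
FanRaspaud = ∀ (G : Graph) → Bridgeless G → Cubic G → Σ (Triple G) (IsFRTriple G)

AllValues : Set
AllValues = ∀ (G : Graph) → Bridgeless G → Cubic G → (e : Fin (m G)) → (i : Fin 3)
            → Σ (Triple G) (λ C → IsFRTriple G C × ν G C e ≡ toℕ i)

module Realise (fanRaspaud : FanRaspaud) (G : Graph) (bridgelessG : Bridgeless G) (cubicG : Cubic G)
               (e : Fin (m G)) (2∣nG : 2 ∣ n G) where

  splice-step : ∀ P j {len} (ks : Vec (Fin (m P)) len) → let open Splice P G j e in
                (T : Triple H) → IsFRTriple H T → All (RealisedAt G e H T) (Vec.map edgeP ks) →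
                Σ (Triple P) (λ T′ → IsFRTriple P T′ × All (RealisedAt G e P T′) (j ∷ ks))
  splice-step P j ks T frT realised =
    restrictᴾ 2∣nG T , frT ∘ edgeP ,
    (restrictᴳ 2∣nG T , frT ∘ edgeG , ν-restrict-cut 2∣nG T) ∷ All.map⁻ realised
    where open Splice P G j e

  realise : ∀ {len} P → Bridgeless P → Cubic P → (ks : Vec (Fin (m P)) len) →
            Σ (Triple P) (λ T → IsFRTriple P T × All (RealisedAt G e P T) ks)
  realise P bridgelessP cubicP [] = let (T , frT) = fanRaspaud P bridgelessP cubicP in T , frT , []
  realise P bridgelessP cubicP (j ∷ ks) =
    let (T , frT , realised) =
          realise H (bridgeless bridgelessP bridgelessG) (cubic cubicP cubicG) (Vec.map edgeP ks)
    in  splice-step P j ks T frT realised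
    where open Splice P G j e

  realise-everywhere : Σ (Triple G) (λ T → IsFRTriple G T × (∀ k → RealisedAt G e G T k))
  realise-everywhere =
    let (T , frT , realised) = realise G bridgelessG cubicG (Vec.allFin (m G))
    in  T , frT , λ k → subst (RealisedAt G e G T) (lookup-allFin k) (All.lookup⁺ realised k)

χ≤1 : ∀ b → χ b ≤ 1
χ≤1 false = z≤n
χ≤1 true  = s≤s z≤n

χ-sum≤2 : ∀ a b c → ¬ (a ≡ true × b ≡ true × c ≡ true) → χ a + χ b + χ c ≤ 2
χ-sum≤2 true  true  true  notAll = ⊥-elim (notAll (refl , refl , refl))
χ-sum≤2 true  true  false _      = ≤-refl
χ-sum≤2 true  false c     _      = s≤s (χ≤1 c)
χ-sum≤2 false b     c     _      = +-mono-≤ (χ≤1 b) (χ≤1 c)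

≤2∧≢1⇒0⊎2 : ∀ {n} → n ≤ 2 → n ≢ 1 → n ≡ 0 ⊎ n ≡ 2
≤2∧≢1⇒0⊎2 {0}     _                 _   = inj₁ refl
≤2∧≢1⇒0⊎2 {1}     _                 n≢1 = contradiction refl n≢1
≤2∧≢1⇒0⊎2 {2}     _                 _   = inj₂ refl
≤2∧≢1⇒0⊎2 {suc (suc (suc _))} (s≤s (s≤s ())) _

2∤3 : ¬ 2 ∣ 3
2∤3 2∣3 = 2∤1 (∣m+n∣m⇒∣n {m = 2} {n = 1} 2∣3 ∣-refl)

incident-end₁ : ∀ Γ (f : Fin (m Γ)) → incident Γ f (end₁ Γ f) ≡ true
incident-end₁ Γ f rewrite ≟ᵇ-refl (end₁ Γ f) = refl

module FRTripleValues (G : Graph) (cubicG : Cubic G) (T : Triple G) (frT : IsFRTriple G T) where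

  private
    M₁ M₂ M₃ : PerfectMatching G
    M₁ = proj₁ T
    M₂ = proj₁ (proj₂ T)
    M₃ = proj₂ (proj₂ T)

    F₁ F₂ F₃ : EdgeSet G
    F₁ = proj₁ M₁
    F₂ = proj₁ M₂
    F₃ = proj₁ M₃

  ν≤2 : ∀ g → ν G T g ≤ 2
  ν≤2 g = χ-sum≤2 (F₁ g) (F₂ g) (F₃ g) (frT g)

  νAt : Fin (n G) → Fin (m G) → ℕ
  νAt a g = if incident G g a then ν G T g else 0

  sum-νAt : ∀ a → sum (νAt a) ≡ 3
  sum-νAt a = begin
    sum (νAt a)
      ≡⟨ sum-cong-≗ by-colour ⟩
    sum (λ g → χ (A₁ g) + χ (A₂ g) + χ (A₃ g))
      ≡⟨ ∑-distrib-+ (λ g → χ (A₁ g) + χ (A₂ g)) (χ ∘ A₃) ⟩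
    sum (λ g → χ (A₁ g) + χ (A₂ g)) + sum (χ ∘ A₃)
      ≡⟨ cong (_+ sum (χ ∘ A₃)) (∑-distrib-+ (χ ∘ A₁) (χ ∘ A₂)) ⟩
    sum (χ ∘ A₁) + sum (χ ∘ A₂) + sum (χ ∘ A₃)
      ≡⟨ cong₂ _+_ (cong₂ _+_ (matched (proj₂ M₁)) (matched (proj₂ M₂))) (matched (proj₂ M₃)) ⟩
    3 ∎
    where
    open ≡-Reasoning
    A₁ A₂ A₃ : Fin (m G) → Bool
    A₁ g = F₁ g ∧ incident G g a
    A₂ g = F₂ g ∧ incident G g a
    A₃ g = F₃ g ∧ incident G g a
    matched : ∀ {F} → IsPerfectMatching G F → sum (λ g → χ (F g ∧ incident G g a)) ≡ 1
    matched {F} isPM = trans (sym (count≡sum (λ g → F g ∧ incident G g a))) (isPM a)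
    by-colour : ∀ g → νAt a g ≡ χ (A₁ g) + χ (A₂ g) + χ (A₃ g)
    by-colour g with incident G g a
    ... | true  rewrite ∧-identityʳ (F₁ g) | ∧-identityʳ (F₂ g) | ∧-identityʳ (F₃ g) = refl
    ... | false rewrite ∧-zeroʳ (F₁ g) | ∧-zeroʳ (F₂ g) | ∧-zeroʳ (F₃ g) = refl

  ∃ν≡1 : Fin (n G) → ∃[ g ] ν G T g ≡ 1
  ∃ν≡1 a with any? (λ g → ν G T g ≟ℕ 1)
  ... | yes found = found
  ... | no none   = ⊥-elim (2∤3 (subst (2 ∣_) (sum-νAt a) (∣-sum even)))
    where
    even : ∀ g → 2 ∣ νAt a g
    even g with incident G g a
    ... | false = 2 ∣0
    ... | true with ≤2∧≢1⇒0⊎2 (ν≤2 g) (λ ν≡1 → none (g , ν≡1))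
    ...   | inj₁ ν≡0 = subst (2 ∣_) (sym ν≡0) (2 ∣0)
    ...   | inj₂ ν≡2 = subst (2 ∣_) (sym ν≡2) ∣-refl

  private
    sum-incident : ∀ a → sum (λ g → χ (incident G g a)) ≡ 3
    sum-incident a = trans (sym (count≡sum (λ g → incident G g a))) (cubicG a)

  -- If no edge had ν = 2 (resp. ν = 0), then νAt a ≤ [· ∋ a] (resp. ≥) pointwise, strictly at k,
  -- for a = end₁ k; but both sides sum to 3.
  ν≡0⇒∃ν≡2 : ∀ k → ν G T k ≡ 0 → ∃[ g ] ν G T g ≡ 2
  ν≡0⇒∃ν≡2 k ν≡0 with any? (λ g → ν G T g ≟ℕ 2)
  ... | yes found = found
  ... | no none   = ⊥-elim (<-irrefl refl (subst₂ _<_ (sum-νAt a) (sum-incident a)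
                      (sum-mono-< (νAt a) (λ g → χ (incident G g a)) k below strict)))
    where
    a : Fin (n G)
    a = end₁ G k
    below : ∀ g → νAt a g ≤ χ (incident G g a)
    below g with incident G g a
    ... | false = z≤n
    ... | true  = s≤s⁻¹ (≤∧≢⇒< (ν≤2 g) (λ ν≡2 → none (g , ν≡2)))
    strict : νAt a k < χ (incident G k a)
    strict rewrite incident-end₁ G k | ν≡0 = s≤s z≤n

  ν≡2⇒∃ν≡0 : ∀ k → ν G T k ≡ 2 → ∃[ g ] ν G T g ≡ 0
  ν≡2⇒∃ν≡0 k ν≡2 with any? (λ g → ν G T g ≟ℕ 0)
  ... | yes found = found
  ... | no none   = ⊥-elim (<-irrefl refl (subst₂ _<_ (sum-incident a) (sum-νAt a)
                      (sum-mono-< (λ g → χ (incident G g a)) (νAt a) k above strict)))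
    where
    a : Fin (n G)
    a = end₁ G k
    above : ∀ g → χ (incident G g a) ≤ νAt a g
    above g with incident G g a
    ... | false = z≤n
    ... | true  = n≢0⇒n>0 (λ ν≡0 → none (g , ν≡0))
    strict : χ (incident G k a) < νAt a k
    strict rewrite incident-end₁ G k | ν≡2 = s≤s (s≤s z≤n)

  ν≢1⇒allValues : ∀ k → ν G T k ≢ 1 → ∀ (i : Fin 3) → ∃[ g ] ν G T g ≡ toℕ i
  ν≢1⇒allValues k ν≢1 zero with ≤2∧≢1⇒0⊎2 (ν≤2 k) ν≢1
  ... | inj₁ ν≡0 = k , ν≡0
  ... | inj₂ ν≡2 = ν≡2⇒∃ν≡0 k ν≡2
  ν≢1⇒allValues k ν≢1 (suc zero) = ∃ν≡1 (end₁ G k)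
  ν≢1⇒allValues k ν≢1 (suc (suc zero)) with ≤2∧≢1⇒0⊎2 (ν≤2 k) ν≢1
  ... | inj₁ ν≡0 = ν≡0⇒∃ν≡2 k ν≡0
  ... | inj₂ ν≡2 = k , ν≡2

Disjoint : (G : Graph) → EdgeSet G → EdgeSet G → Set
Disjoint G A B = ∀ g → A g ∧ B g ≡ false

ABA-isFRTriple : ∀ G (A B : PerfectMatching G) → Disjoint G (proj₁ A) (proj₁ B) → IsFRTriple G (A , B , A)
ABA-isFRTriple G A B disjoint g (inA , inB , _) with () ← trans (sym (cong₂ _∧_ inA inB)) (disjoint g)

χ-sum≡1⇒disjoint : ∀ a b c → χ a + χ b + χ c ≡ 1 → a ∧ b ≡ false × b ∧ c ≡ false × c ∧ a ≡ false
χ-sum≡1⇒disjoint true  false false _ = refl , refl , refl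
χ-sum≡1⇒disjoint false true  false _ = refl , refl , refl
χ-sum≡1⇒disjoint false false true  _ = refl , refl , refl
χ-sum≡1⇒disjoint false false false ()
χ-sum≡1⇒disjoint true  true  _     ()
χ-sum≡1⇒disjoint true  false true  ()
χ-sum≡1⇒disjoint false true  true  ()

module ThreeEdgeColouring (G : Graph) (T : Triple G) (ν≡1 : ∀ g → ν G T g ≡ 1) (e : Fin (m G)) where

  private
    M₁ M₂ M₃ : PerfectMatching G
    M₁ = proj₁ T
    M₂ = proj₁ (proj₂ T)
    M₃ = proj₂ (proj₂ T)

    disjoint : ∀ g → let a = proj₁ M₁ g; b = proj₁ M₂ g; c = proj₁ M₃ g in
               a ∧ b ≡ false × b ∧ c ≡ false × c ∧ a ≡ false
    disjoint g = χ-sum≡1⇒disjoint (proj₁ M₁ g) (proj₁ M₂ g) (proj₁ M₃ g) (ν≡1 g)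

  ABA : (A B : PerfectMatching G) → Disjoint G (proj₁ A) (proj₁ B) → ∀ {a b} → proj₁ A e ≡ a → proj₁ B e ≡ b →
        Σ (Triple G) (λ C → IsFRTriple G C × ν G C e ≡ χ a + χ b + χ a)
  ABA A B disjointAB refl refl = (A , B , A) , ABA-isFRTriple G A B disjointAB , refl

  realise : IsFRTriple G T → ∀ (i : Fin 3) → Σ (Triple G) (λ C → IsFRTriple G C × ν G C e ≡ toℕ i)
  realise frT (suc zero) = T , frT , ν≡1 e
  realise frT zero with proj₁ M₁ e in e₁ | proj₁ M₂ e in e₂ | proj₁ M₃ e in e₃ | ν≡1 e
  ... | true  | false | false | _ = ABA M₂ M₃ (proj₁ ∘ proj₂ ∘ disjoint) e₂ e₃
  ... | false | true  | false | _ = ABA M₃ M₁ (proj₂ ∘ proj₂ ∘ disjoint) e₃ e₁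
  ... | false | false | true  | _ = ABA M₁ M₂ (proj₁ ∘ disjoint) e₁ e₂
  realise frT (suc (suc zero)) with proj₁ M₁ e in e₁ | proj₁ M₂ e in e₂ | proj₁ M₃ e in e₃ | ν≡1 e
  ... | true  | false | false | _ = ABA M₁ M₂ (proj₁ ∘ disjoint) e₁ e₂
  ... | false | true  | false | _ = ABA M₂ M₃ (proj₁ ∘ proj₂ ∘ disjoint) e₂ e₃
  ... | false | false | true  | _ = ABA M₃ M₁ (proj₂ ∘ proj₂ ∘ disjoint) e₃ e₁

realising-triple⇒values : ∀ G (e : Fin (m G)) → Cubic G → (T : Triple G) → IsFRTriple G T →
                          (∀ k → RealisedAt G e G T k) → ∀ (i : Fin 3) →
                          Σ (Triple G) (λ C → IsFRTriple G C × ν G C e ≡ toℕ i)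
realising-triple⇒values G e cubicG T frT realised i with all? (λ k → ν G T k ≟ℕ 1)
... | yes ν≡1 = ThreeEdgeColouring.realise G T ν≡1 e frT i
... | no ν≢1  =
  let (k , νk≢1)          = ¬∀⟶∃¬ (m G) _ (λ k → ν G T k ≟ℕ 1) ν≢1
      (g , νg≡i)          = FRTripleValues.ν≢1⇒allValues G cubicG T frT k νk≢1 i
      (C , frC , νC≡νg)   = realised g
  in  C , frC , trans νC≡νg νg≡i

FanRaspaud⇒AllValues : FanRaspaud → AllValues
FanRaspaud⇒AllValues fanRaspaud G bridgelessG cubicG e =
  let (T , frT , realised) = Realise.realise-everywhere fanRaspaud G bridgelessG cubicG e 2∣nG
  in  realising-triple⇒values G e cubicG T frT realised
  where
  2∣nG : 2 ∣ n G
  2∣nG = perfectMatching⇒even G (proj₂ (proj₁ (proj₁ (fanRaspaud G bridgelessG cubicG))))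

Fin? : ∀ k → Dec (Fin k)
Fin? zero    = no λ ()
Fin? (suc k) = yes zero

count≡3⇒Fin : ∀ {k} (p : Fin k → Bool) → count p ≡ 3 → Fin k
count≡3⇒Fin {suc k} _ _ = zero

AllValues⇒FanRaspaud : AllValues → FanRaspaud
-- Without edges a cubic graph has no vertices, and the empty edge set is a perfect matching.
AllValues⇒FanRaspaud allValues G bridgelessG cubicG with Fin? (m G)
... | yes e    = let (C , frC , _) = allValues G bridgelessG cubicG e zero in C , frC
... | no empty = (∅ , ∅ , ∅) , λ g → contradiction g empty
  where
  ∅ : PerfectMatching G
  ∅ = (λ _ → false) , λ v → contradiction (count≡3⇒Fin _ (cubicG v)) empty

theorem1 : ((∀ (G : Graph) → Bridgeless G → Cubic G → Σ (Triple G) (IsFRTriple G))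
             → (∀ (G : Graph) → Bridgeless G → Cubic G → (e : Fin (m G)) → (i : Fin 3)
                  → Σ (Triple G) (λ C → IsFRTriple G C × ν G C e ≡ toℕ i)))
           × ((∀ (G : Graph) → Bridgeless G → Cubic G → (e : Fin (m G)) → (i : Fin 3)
                  → Σ (Triple G) (λ C → IsFRTriple G C × ν G C e ≡ toℕ i))
             → (∀ (G : Graph) → Bridgeless G → Cubic G → Σ (Triple G) (IsFRTriple G)))
theorem1 = FanRaspaud⇒AllValues , AllValues⇒FanRaspaud
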